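{- Every flow-admissible string or necklace admits a $(0,0)$-pseudoflow, that is, a nowhere-zero $6$-flow.
   Context: A signed graph is a loopless graph (parallel edges allowed) with edges labelled positive or negative. An orientation treats each edge as two half-edges oriented independently: exactly one half-edge points towards its endvertex for a positive edge, none or both for a negative edge. A nowhere-zero $k$-flow is an orientation with edge values in non-zero integers of absolute value $<k$ such that at every vertex incoming and outgoing totals agree; flow-admissible means admitting a nowhere-zero $k$-flow for some $k$. A pseudoflow on a two-terminal signed graph is defined like a nowhere-zero $6$-flow but without the conservation requirement at the two terminals; an $(a,b)$-pseudoflow has net outflow $a$ at the source and net inflow $b$ at the target. Two-terminal graphs have distinct source and target; series connection of $G_1,\dots,G_n$ identifies the target of $G_i$ with the source of $G_{i+1}$; parallel connection identifies all sources and all targets. $K_2^+$ is the positive $K_2$ and $D$ the unbalanced $2$-cycle (one positive and one negative parallel edge). A string is a series connection of copies of $K_2^+$ and $D$ in which every non-terminal vertex lies in a $2$-cycle; nontrivial if it has more than two vertices. A necklace is the parallel connection of two strings, at least one nontrivial. -}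

module Defs where

open import Data.Nat using (ℕ; zero; suc; _<_; _≤_; _≟_; _+_)
open import Data.Integer using (ℤ; 0ℤ; ∣_∣) renaming (_+_ to _+ℤ_)
open import Data.Bool using (Bool; true; false; if_then_else_; _xor_; _∧_; not)
open import Data.Fin using (Fin; zero; suc)
open import Data.List using (List; []; _∷_; _++_; length; lookup; map)
open import Data.Product using (_×_; _,_; Σ; ∃; ∃₂)
open import Data.Sum using (_⊎_)
open import Relation.Binary.PropositionalEquality using (_≡_; _≢_)
open import Relation.Nullary.Decidable using (⌊_⌋)

-- Only vertices incident with an edge
-- matter for flows; the graphs built below are loopless.

data Sign : Set where
  pos neg : Sign

record Edge : Set where
  constructor edge
  field
    end₁ : ℕ
    end₂ : ℕ
    sign : Sign
open Edge public

SignedGraph : Set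
SignedGraph = List Edge

EdgeOf : SignedGraph → Set
EdgeOf G = Fin (length G)

-- Orientations: each edge is two half-edges (at end₁ and end₂);
-- inᵢ e = true means the half-edge at endᵢ points towards its endvertex.

ValidOrient : Sign → Bool → Bool → Set
ValidOrient pos a b = (a xor b) ≡ true
ValidOrient neg a b = a ≡ b

record Orientation (G : SignedGraph) : Set where
  field
    in₁ : EdgeOf G → Bool
    in₂ : EdgeOf G → Bool
    valid : ∀ e → ValidOrient (sign (lookup G e)) (in₁ e) (in₂ e)
open Orientation public

Σℤ : ∀ {m} → (Fin m → ℤ) → ℤ
Σℤ {zero} f = 0ℤ
Σℤ {suc m} f = f zero +ℤ Σℤ (λ i → f (suc i))

halfVal : ℕ → Bool → Bool → ℕ → ℤ → ℤ
halfVal x d b v a = if ⌊ x ≟ v ⌋ ∧ (if b then d else not d) then a else 0ℤ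

incoming : (G : SignedGraph) → Orientation G → (EdgeOf G → ℤ) → ℕ → ℤ
incoming G o f v = Σℤ λ e →
  halfVal (end₁ (lookup G e)) (in₁ o e) true v (f e)
  +ℤ halfVal (end₂ (lookup G e)) (in₂ o e) true v (f e)

outgoing : (G : SignedGraph) → Orientation G → (EdgeOf G → ℤ) → ℕ → ℤ
outgoing G o f v = Σℤ λ e →
  halfVal (end₁ (lookup G e)) (in₁ o e) false v (f e)
  +ℤ halfVal (end₂ (lookup G e)) (in₂ o e) false v (f e)

NowhereZeroFlow : ℕ → SignedGraph → Set
NowhereZeroFlow k G =
  Σ (Orientation G) λ o →
  Σ (EdgeOf G → ℤ) λ f →
    (∀ e → f e ≢ 0ℤ) ×
    (∀ e → ∣ f e ∣ < k) ×
    (∀ v → incoming G o f v ≡ outgoing G o f v)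

FlowAdmissible : SignedGraph → Set
FlowAdmissible G = ∃ λ k → NowhereZeroFlow k G

SameEnds : Edge → Edge → Set
SameEnds a b = (end₁ a ≡ end₁ b × end₂ a ≡ end₂ b) ⊎ (end₁ a ≡ end₂ b × end₂ a ≡ end₁ b)

LiesIn2Cycle : SignedGraph → ℕ → Set
LiesIn2Cycle G v = ∃₂ λ (e e′ : EdgeOf G) →
  e ≢ e′ × SameEnds (lookup G e) (lookup G e′) ×
  (v ≡ end₁ (lookup G e) ⊎ v ≡ end₂ (lookup G e))

data Block : Set where
  K2⁺ D : Block

blockEdges : Block → ℕ → ℕ → List Edge
blockEdges K2⁺ u w = edge u w pos ∷ []
blockEdges D   u w = edge u w pos ∷ edge u w neg ∷ []

seriesEdges : (ℕ → ℕ) → ℕ → List Block → List Edge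
seriesEdges φ i [] = []
seriesEdges φ i (b ∷ bs) = blockEdges b (φ i) (φ (suc i)) ++ seriesEdges φ (suc i) bs

seriesGraph : List Block → SignedGraph
seriesGraph bs = seriesEdges (λ i → i) 0 bs

IsString : List Block → Set
IsString bs = 1 ≤ length bs ×
  (∀ i → 0 < i → i < length bs → LiesIn2Cycle (seriesGraph bs) i)

Nontrivial : List Block → Set
Nontrivial bs = 2 ≤ length bs

-- The first string keeps vertices 0 .. ℓ₁ (source 0, target ℓ₁);
-- vertex j of the second string (of length ℓ₂) is sent to 0 if j = 0,
-- to ℓ₁ if j = ℓ₂, and to ℓ₁ + j otherwise (a fresh vertex).

relabel : ℕ → ℕ → ℕ → ℕ
relabel ℓ₁ ℓ₂ zero = zero
relabel ℓ₁ ℓ₂ (suc j) = if ⌊ suc j ≟ ℓ₂ ⌋ then ℓ₁ else ℓ₁ + suc j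

necklaceGraph : List Block → List Block → SignedGraph
necklaceGraph bs cs =
  seriesGraph bs ++ seriesEdges (relabel (length bs) (length cs)) 0 cs

IsNecklace : List Block → List Block → Set
IsNecklace bs cs = IsString bs × IsString cs × (Nontrivial bs ⊎ Nontrivial cs)

-- A nowhere-zero flow is exactly an assignment whose divergence (incoming
-- minus outgoing value) vanishes at every vertex.  Two configurations admit
-- no nowhere-zero flow at all: a vertex of degree one, and a single negative
-- edge (summed over all vertices the divergence vanishes on positive edges
-- and is twice the value on a negative one).  So a flow-admissible string
-- starts and ends with D, and a flow-admissible necklace has at least two D
-- blocks, a nontrivial string without D having a vertex outside every
-- 2-cycle.  On such graphs a 6-flow is assembled block by block from
-- pseudoflows: a D block with values p, q turns excess p + q into p − q.
-- Along a string the excess 0 is turned into 2, then alternates between 2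
-- and 4 and is absorbed by the last D.  On a necklace both strings carry the
-- odd excesses 1, 3, 5, each D block moving to a different one (a walk in a
-- triangle), so both strings can reach a common excess at the target, and
-- the second string carries the negated pseudoflow.

module Submission where

open import Defs
open import Data.Bool using (Bool; true; false; if_then_else_)
open import Data.Empty using (⊥-elim)
open import Data.Fin using (Fin; zero; suc; toℕ)
open import Data.Fin.Properties using (toℕ-injective)
open import Data.Integer using (ℤ; 0ℤ; +_; +[1+_]; -[1+_]; -_; _-_; ∣_∣) renaming (_+_ to _+ℤ_)
import Data.Integer.Properties as ℤ
open import Data.Integer.Tactic.RingSolver using (solve-∀)
open import Data.List using (List; []; _∷_; _++_; _∷ʳ_; length; lookup; map; initLast; _∷ʳ′_)
open import Data.List.Properties using (++-identityʳ; ++-assoc; map-++)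
open import Data.Nat using (ℕ; zero; suc; _+_; _<_; _≤_; _≟_; _<?_; z≤n; s≤s)
import Data.Nat.Properties as ℕ
open import Data.Nat.ListAction using (sum)
open import Data.Nat.ListAction.Properties using (sum-++)
open import Data.Product using (Σ; _×_; _,_; proj₁; proj₂)
open import Data.Sum using (_⊎_; inj₁; inj₂)
import Data.Sum as Sum
open import Data.Unit using (⊤; tt)
open import Function using (_∘_; id)
open import Relation.Binary.PropositionalEquality
open import Relation.Nullary using (¬_; Dec; yes; no)
open import Relation.Nullary.Decidable using (⌊_⌋; True; toWitness; ¬?; _×-dec_)
open import Algebra.Properties.CommutativeSemigroup ℤ.+-commutativeSemigroup
  using () renaming (interchange to +-interchange)

Σℤ-cong : ∀ {m} {f g : Fin m → ℤ} → (∀ i → f i ≡ g i) → Σℤ f ≡ Σℤ g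
Σℤ-cong {zero}  f≡g = refl
Σℤ-cong {suc m} f≡g = cong₂ _+ℤ_ (f≡g zero) (Σℤ-cong (λ i → f≡g (suc i)))

Σℤ-zero : ∀ {m} (f : Fin m → ℤ) → (∀ i → f i ≡ 0ℤ) → Σℤ f ≡ 0ℤ
Σℤ-zero {zero}  f f≡0 = refl
Σℤ-zero {suc m} f f≡0 = cong₂ _+ℤ_ (f≡0 zero) (Σℤ-zero (λ i → f (suc i)) (λ i → f≡0 (suc i)))

Σℤ-+ : ∀ {m} (f g : Fin m → ℤ) → Σℤ (λ i → f i +ℤ g i) ≡ Σℤ f +ℤ Σℤ g
Σℤ-+ {zero}  f g = refl
Σℤ-+ {suc m} f g =
  trans (cong ((f zero +ℤ g zero) +ℤ_) (Σℤ-+ (λ i → f (suc i)) (λ i → g (suc i))))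
        (+-interchange (f zero) (g zero) _ _)

Σℤ-comm : ∀ {m n} (F : Fin m → Fin n → ℤ) →
  Σℤ (λ i → Σℤ (F i)) ≡ Σℤ (λ j → Σℤ (λ i → F i j))
Σℤ-comm {zero} {n} F = sym (Σℤ-zero {n} _ (λ _ → refl))
Σℤ-comm {suc m} F =
  trans (cong (Σℤ (F zero) +ℤ_) (Σℤ-comm (λ i → F (suc i))))
        (sym (Σℤ-+ (F zero) _))

count≡0⇒Σℤ≡0 : (c : Edge → ℕ) (G : SignedGraph) (w : EdgeOf G → ℤ) →
  (∀ e → c (lookup G e) ≡ 0 → w e ≡ 0ℤ) → sum (map c G) ≡ 0 → Σℤ w ≡ 0ℤ
count≡0⇒Σℤ≡0 c []      w w≡0 count≡0 = refl
count≡0⇒Σℤ≡0 c (x ∷ G) w w≡0 count≡0 =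
  cong₂ _+ℤ_ (w≡0 zero (ℕ.m+n≡0⇒m≡0 (c x) count≡0))
             (count≡0⇒Σℤ≡0 c G (w ∘ suc) (w≡0 ∘ suc) (ℕ.m+n≡0⇒n≡0 (c x) count≡0))

count≡1⇒Σℤ≢0 : (c : Edge → ℕ) (G : SignedGraph) (w : EdgeOf G → ℤ) →
  (∀ e → c (lookup G e) ≡ 0 → w e ≡ 0ℤ) → (∀ e → c (lookup G e) ≡ 1 → w e ≢ 0ℤ) →
  sum (map c G) ≡ 1 → Σℤ w ≢ 0ℤ
count≡1⇒Σℤ≢0 c (x ∷ G) w w≡0 w≢0 count≡1 Σ≡0 with c x in cx
... | 0 = count≡1⇒Σℤ≢0 c G (w ∘ suc) (w≡0 ∘ suc) (w≢0 ∘ suc) count≡1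
            (trans (sym (ℤ.+-identityˡ _)) (trans (cong (_+ℤ Σℤ (w ∘ suc)) (sym (w≡0 zero cx))) Σ≡0))
... | 1 = w≢0 zero cx
            (trans (sym (ℤ.+-identityʳ _)) (trans (cong (w zero +ℤ_) (sym rest≡0)) Σ≡0))
  where
  rest≡0 : Σℤ (w ∘ suc) ≡ 0ℤ
  rest≡0 = count≡0⇒Σℤ≡0 c G (w ∘ suc) (w≡0 ∘ suc) (ℕ.suc-injective count≡1)
count≡1⇒Σℤ≢0 c (x ∷ G) w w≡0 w≢0 () Σ≡0 | suc (suc _)

at : ℕ → ℕ → ℤ → ℤ
at x v a = if ⌊ x ≟ v ⌋ then a else 0ℤ

orient : Bool → ℤ → ℤ
orient d a = if d then a else - a

at-≡ : ∀ x a → at x x a ≡ a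
at-≡ x a with x ≟ x
... | yes _  = refl
... | no x≢x = ⊥-elim (x≢x refl)

at-≢ : ∀ x v a → x ≢ v → at x v a ≡ 0ℤ
at-≢ x v a x≢v with x ≟ v
... | yes x≡v = ⊥-elim (x≢v x≡v)
... | no _    = refl

at-suc : ∀ x v a → at (suc x) (suc v) a ≡ at x v a
at-suc x v a with x ≟ v
... | yes refl = at-≡ (suc x) a
... | no x≢v   = at-≢ (suc x) (suc v) a (x≢v ∘ ℕ.suc-injective)

at-+ : ∀ x v a b → at x v (a +ℤ b) ≡ at x v a +ℤ at x v b
at-+ x v a b with ⌊ x ≟ v ⌋
... | true  = refl
... | false = refl

at-neg : ∀ x v a → at x v (- a) ≡ - at x v a
at-neg x v a with ⌊ x ≟ v ⌋
... | true  = refl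
... | false = refl

at-− : ∀ x v a b → at x v (a - b) ≡ at x v a - at x v b
at-− x v a b = trans (at-+ x v a (- b)) (cong (at x v a +ℤ_) (at-neg x v b))

at-0 : ∀ x v → at x v 0ℤ ≡ 0ℤ
at-0 x v with ⌊ x ≟ v ⌋
... | true  = refl
... | false = refl

Σℤ-at : ∀ N x a → x < N → Σℤ {N} (λ v → at x (toℕ v) a) ≡ a
Σℤ-at (suc N) zero a _ = begin
  at 0 0 a +ℤ Σℤ {N} (λ v → at 0 (suc (toℕ v)) a)
    ≡⟨ cong₂ _+ℤ_ (at-≡ 0 a) (Σℤ-zero {N} _ (λ v → at-≢ 0 (suc (toℕ v)) a λ ())) ⟩
  a +ℤ 0ℤ ≡⟨ ℤ.+-identityʳ a ⟩
  a       ∎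
  where open ≡-Reasoning
Σℤ-at (suc N) (suc x) a (s≤s x<N) = begin
  at (suc x) 0 a +ℤ Σℤ {N} (λ v → at (suc x) (suc (toℕ v)) a)
    ≡⟨ cong₂ _+ℤ_ (at-≢ (suc x) 0 a λ ()) (Σℤ-cong {N} (λ v → at-suc x (toℕ v) a)) ⟩
  0ℤ +ℤ Σℤ {N} (λ v → at x (toℕ v) a) ≡⟨ ℤ.+-identityˡ _ ⟩
  Σℤ {N} (λ v → at x (toℕ v) a)       ≡⟨ Σℤ-at N x a x<N ⟩
  a                                   ∎
  where open ≡-Reasoning

edgeDivergence : Edge → Bool → Bool → ℤ → ℕ → ℤ
edgeDivergence x d₁ d₂ a v = at (end₁ x) v (orient d₁ a) +ℤ at (end₂ x) v (orient d₂ a)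

divergence : (G : SignedGraph) → Orientation G → (EdgeOf G → ℤ) → ℕ → ℤ
divergence G o f v = Σℤ λ e → edgeDivergence (lookup G e) (in₁ o e) (in₂ o e) (f e) v

halfVal-in : ∀ x d v a → halfVal x d true v a ≡ at x v (orient d a) +ℤ halfVal x d false v a
halfVal-in x d v a with ⌊ x ≟ v ⌋
halfVal-in x true  v a | true  = sym (ℤ.+-identityʳ a)
halfVal-in x false v a | true  = sym (ℤ.+-inverseˡ a)
halfVal-in x d     v a | false = refl

incoming≡divergence+outgoing : ∀ G o f v →
  incoming G o f v ≡ divergence G o f v +ℤ outgoing G o f v
incoming≡divergence+outgoing G o f v =
  trans (Σℤ-cong λ e → trans (cong₂ _+ℤ_ (halfVal-in (x₁ e) (in₁ o e) v (f e))
                                         (halfVal-in (x₂ e) (in₂ o e) v (f e)))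
                             (+-interchange (at₁ e) (out₁ e) (at₂ e) (out₂ e)))
        (Σℤ-+ (λ e → at₁ e +ℤ at₂ e) (λ e → out₁ e +ℤ out₂ e))
  where
  x₁ x₂ : EdgeOf G → ℕ
  x₁ e = end₁ (lookup G e)
  x₂ e = end₂ (lookup G e)
  at₁ at₂ out₁ out₂ : EdgeOf G → ℤ
  at₁ e = at (x₁ e) v (orient (in₁ o e) (f e))
  at₂ e = at (x₂ e) v (orient (in₂ o e) (f e))
  out₁ e = halfVal (x₁ e) (in₁ o e) false v (f e)
  out₂ e = halfVal (x₂ e) (in₂ o e) false v (f e)

conservation⇒divergence≡0 : ∀ G o f → (∀ v → incoming G o f v ≡ outgoing G o f v) →
  ∀ v → divergence G o f v ≡ 0ℤ
conservation⇒divergence≡0 G o f conserved v = begin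
  div                    ≡⟨ add-sub div out ⟩
  (div +ℤ out) - out     ≡⟨ cong (_- out) (sym (incoming≡divergence+outgoing G o f v)) ⟩
  incoming G o f v - out ≡⟨ cong (_- out) (conserved v) ⟩
  out - out              ≡⟨ ℤ.+-inverseʳ out ⟩
  0ℤ                     ∎
  where
  open ≡-Reasoning
  div = divergence G o f v
  out = outgoing G o f v
  add-sub : ∀ a b → a ≡ (a +ℤ b) - b
  add-sub = solve-∀

divergence≡0⇒conservation : ∀ G o f → (∀ v → divergence G o f v ≡ 0ℤ) →
  ∀ v → incoming G o f v ≡ outgoing G o f v
divergence≡0⇒conservation G o f div≡0 v =
  trans (incoming≡divergence+outgoing G o f v)
        (trans (cong (_+ℤ outgoing G o f v) (div≡0 v)) (ℤ.+-identityˡ _))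

incidence : ℕ → ℕ → ℕ
incidence x v = if ⌊ x ≟ v ⌋ then 1 else 0

endsAt : ℕ → Edge → ℕ
endsAt v x = incidence (end₁ x) v + incidence (end₂ x) v

degree : SignedGraph → ℕ → ℕ
degree G v = sum (map (endsAt v) G)

orient-nonzero : ∀ d {a} → a ≢ 0ℤ → orient d a ≢ 0ℤ
orient-nonzero true  a≢0 = a≢0
orient-nonzero false a≢0 -a≡0 = a≢0 (ℤ.neg-injective -a≡0)

edgeDivergence-away : ∀ x d₁ d₂ a v → endsAt v x ≡ 0 → edgeDivergence x d₁ d₂ a v ≡ 0ℤ
edgeDivergence-away x d₁ d₂ a v with ⌊ end₁ x ≟ v ⌋ | ⌊ end₂ x ≟ v ⌋
... | false | false = λ _ → refl
... | false | true  = λ ()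
... | true  | _     = λ ()

edgeDivergence-pendant : ∀ x d₁ d₂ {a} v → a ≢ 0ℤ → endsAt v x ≡ 1 →
  edgeDivergence x d₁ d₂ a v ≢ 0ℤ
edgeDivergence-pendant x d₁ d₂ v a≢0 with ⌊ end₁ x ≟ v ⌋ | ⌊ end₂ x ≟ v ⌋
... | false | false = λ ()
... | true  | true  = λ ()
... | true  | false = λ _ eq → orient-nonzero d₁ a≢0 (trans (sym (ℤ.+-identityʳ _)) eq)
... | false | true  = λ _ eq → orient-nonzero d₂ a≢0 (trans (sym (ℤ.+-identityˡ _)) eq)

degree≡1⇒¬flow : ∀ G k v → degree G v ≡ 1 → ¬ NowhereZeroFlow k G
degree≡1⇒¬flow G k v deg≡1 (o , f , f≢0 , _ , conserved) =
  count≡1⇒Σℤ≢0 (endsAt v) G _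
    (λ e → edgeDivergence-away (lookup G e) (in₁ o e) (in₂ o e) (f e) v)
    (λ e → edgeDivergence-pendant (lookup G e) (in₁ o e) (in₂ o e) v (f≢0 e))
    deg≡1 (conservation⇒divergence≡0 G o f conserved v)

negativity : Sign → ℕ
negativity pos = 0
negativity neg = 1

negatives : SignedGraph → ℕ
negatives G = sum (map (λ x → negativity (sign x)) G)

vertexBound : SignedGraph → ℕ
vertexBound []      = 0
vertexBound (x ∷ G) = suc (end₁ x + end₂ x) + vertexBound G

end₁<vertexBound : ∀ G e → end₁ (lookup G e) < vertexBound G
end₁<vertexBound (x ∷ G) zero    = ℕ.≤-trans (s≤s (ℕ.m≤m+n (end₁ x) (end₂ x))) (ℕ.m≤m+n _ _)
end₁<vertexBound (x ∷ G) (suc e) = ℕ.≤-trans (end₁<vertexBound G e) (ℕ.m≤n+m _ _)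

end₂<vertexBound : ∀ G e → end₂ (lookup G e) < vertexBound G
end₂<vertexBound (x ∷ G) zero    = ℕ.≤-trans (s≤s (ℕ.m≤n+m (end₂ x) (end₁ x))) (ℕ.m≤m+n _ _)
end₂<vertexBound (x ∷ G) (suc e) = ℕ.≤-trans (end₂<vertexBound G e) (ℕ.m≤n+m _ _)

Σℤ-divergence : ∀ G o f →
  Σℤ {vertexBound G} (λ v → divergence G o f (toℕ v))
  ≡ Σℤ (λ e → orient (in₁ o e) (f e) +ℤ orient (in₂ o e) (f e))
Σℤ-divergence G o f =
  trans (Σℤ-comm {vertexBound G} (λ v e → at₁ e v +ℤ at₂ e v))
        (Σℤ-cong λ e → trans (Σℤ-+ {vertexBound G} (at₁ e) (at₂ e))
                             (cong₂ _+ℤ_ (Σℤ-at _ _ _ (end₁<vertexBound G e))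
                                         (Σℤ-at _ _ _ (end₂<vertexBound G e))))
  where
  at₁ at₂ : EdgeOf G → Fin (vertexBound G) → ℤ
  at₁ e v = at (end₁ (lookup G e)) (toℕ v) (orient (in₁ o e) (f e))
  at₂ e v = at (end₂ (lookup G e)) (toℕ v) (orient (in₂ o e) (f e))

double-nonzero : ∀ {a} → a ≢ 0ℤ → a +ℤ a ≢ 0ℤ
double-nonzero {+ zero}   a≢0 _ = a≢0 refl
double-nonzero {+[1+ n ]} a≢0 ()
double-nonzero { -[1+ n ]} a≢0 ()

orient-cancel-pos : ∀ s d₁ d₂ a → ValidOrient s d₁ d₂ → negativity s ≡ 0 →
  orient d₁ a +ℤ orient d₂ a ≡ 0ℤ
orient-cancel-pos pos true  false a _ _ = ℤ.+-inverseʳ a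
orient-cancel-pos pos false true  a _ _ = ℤ.+-inverseˡ a

orient-double-neg : ∀ s d₁ d₂ {a} → a ≢ 0ℤ → ValidOrient s d₁ d₂ → negativity s ≡ 1 →
  orient d₁ a +ℤ orient d₂ a ≢ 0ℤ
orient-double-neg neg d .d a≢0 refl _ = double-nonzero (orient-nonzero d a≢0)

negatives≡1⇒¬flow : ∀ G k → negatives G ≡ 1 → ¬ NowhereZeroFlow k G
negatives≡1⇒¬flow G k neg≡1 (o , f , f≢0 , _ , conserved) =
  count≡1⇒Σℤ≢0 (λ x → negativity (sign x)) G _
    (λ e → orient-cancel-pos _ _ _ (f e) (valid o e))
    (λ e → orient-double-neg _ _ _ (f≢0 e) (valid o e))
    neg≡1
    (trans (sym (Σℤ-divergence G o f))
           (Σℤ-zero {vertexBound G} _ (λ v → conservation⇒divergence≡0 G o f conserved (toℕ v))))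

FlowValue : ℤ → Set
FlowValue x = x ≢ 0ℤ × ∣ x ∣ < 6

flowValue? : ∀ x → Dec (FlowValue x)
flowValue? x = ¬? (x ℤ.≟ 0ℤ) ×-dec (∣ x ∣ <? 6)

flowValue : ∀ x → {True (flowValue? x)} → FlowValue x
flowValue x {x✓} = toWitness x✓

FlowValue-neg : ∀ {x} → FlowValue x → FlowValue (- x)
FlowValue-neg {x} (x≢0 , ∣x∣<6) =
  (λ -x≡0 → x≢0 (ℤ.neg-injective -x≡0)) , subst (_< 6) (sym (ℤ.∣-i∣≡∣i∣ x)) ∣x∣<6

-- The edge values, under the orientation `canonical` below, of an
-- (a, b)-pseudoflow on the series connection of bs; in a D block the
-- positive edge carries p and the negative edge q.
data Pseudoflow : List Block → ℤ → ℤ → Set where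
  []   : ∀ {a} → Pseudoflow [] a a
  K2⁺∷ : ∀ {bs a b} → FlowValue a → Pseudoflow bs a b → Pseudoflow (K2⁺ ∷ bs) a b
  D∷   : ∀ {bs a a′ b} p q → FlowValue p → FlowValue q → p +ℤ q ≡ a → p - q ≡ a′ →
         Pseudoflow bs a′ b → Pseudoflow (D ∷ bs) a b

Pseudoflow-neg : ∀ {bs a b} → Pseudoflow bs a b → Pseudoflow bs (- a) (- b)
Pseudoflow-neg []               = []
Pseudoflow-neg (K2⁺∷ a✓ w)      = K2⁺∷ (FlowValue-neg a✓) (Pseudoflow-neg w)
Pseudoflow-neg (D∷ p q p✓ q✓ refl refl w) =
  D∷ (- p) (- q) (FlowValue-neg p✓) (FlowValue-neg q✓)
     (sym (ℤ.neg-distrib-+ p q)) (sym (ℤ.neg-distrib-+ p (- q))) (Pseudoflow-neg w)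

targetIndex : ℕ → List Block → ℕ
targetIndex i []       = i
targetIndex i (_ ∷ bs) = targetIndex (suc i) bs

targetIndex-length : ∀ i bs → targetIndex i bs ≡ i + length bs
targetIndex-length i []       = sym (ℕ.+-identityʳ i)
targetIndex-length i (_ ∷ bs) = trans (targetIndex-length (suc i) bs) (sym (ℕ.+-suc i (length bs)))

values : ∀ {bs a b} → Pseudoflow bs a b → ∀ φ i R → (EdgeOf R → ℤ) →
  EdgeOf (seriesEdges φ i bs ++ R) → ℤ
values []                   φ i R g e             = g e
values {a = a} (K2⁺∷ _ w)   φ i R g zero          = a
values (K2⁺∷ _ w)           φ i R g (suc e)       = values w φ (suc i) R g e
values (D∷ p q _ _ _ _ w)   φ i R g zero          = p
values (D∷ p q _ _ _ _ w)   φ i R g (suc zero)    = q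
values (D∷ p q _ _ _ _ w)   φ i R g (suc (suc e)) = values w φ (suc i) R g e

values-FlowValue : ∀ {bs a b} (w : Pseudoflow bs a b) φ i R g → (∀ e → FlowValue (g e)) →
  ∀ e → FlowValue (values w φ i R g e)
values-FlowValue []                   φ i R g g✓ e             = g✓ e
values-FlowValue (K2⁺∷ a✓ w)          φ i R g g✓ zero          = a✓
values-FlowValue (K2⁺∷ _ w)           φ i R g g✓ (suc e)       = values-FlowValue w φ (suc i) R g g✓ e
values-FlowValue (D∷ p q p✓ q✓ _ _ w) φ i R g g✓ zero          = p✓
values-FlowValue (D∷ p q p✓ q✓ _ _ w) φ i R g g✓ (suc zero)    = q✓
values-FlowValue (D∷ p q _ _ _ _ w)   φ i R g g✓ (suc (suc e)) = values-FlowValue w φ (suc i) R g g✓ e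

isNegative : Sign → Bool
isNegative pos = false
isNegative neg = true

canonical-valid : ∀ s → ValidOrient s true (isNegative s)
canonical-valid pos = refl
canonical-valid neg = refl

canonical : (G : SignedGraph) → Orientation G
canonical G = record
  { in₁ = λ _ → true
  ; in₂ = λ e → isNegative (sign (lookup G e))
  ; valid = λ e → canonical-valid (sign (lookup G e))
  }

divergence-series : ∀ {bs a b} (w : Pseudoflow bs a b) φ i R g v →
  divergence (seriesEdges φ i bs ++ R) (canonical _) (values w φ i R g) v
  ≡ (at (φ i) v a - at (φ (targetIndex i bs)) v b) +ℤ divergence R (canonical R) g v
divergence-series {a = a} [] φ i R g v = sym (cancel (at (φ i) v a) _)
  where
  cancel : ∀ x r → (x - x) +ℤ r ≡ r
  cancel = solve-∀
divergence-series {K2⁺ ∷ bs} {a} {b} (K2⁺∷ _ w) φ i R g v = begin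
  (at u v a +ℤ at u′ v (- a)) +ℤ rest
    ≡⟨ cong₂ _+ℤ_ (cong (at u v a +ℤ_) (at-neg u′ v a)) (divergence-series w φ (suc i) R g v) ⟩
  (at u v a - at u′ v a) +ℤ ((at u′ v a - t) +ℤ r)
    ≡⟨ telescope (at u v a) (at u′ v a) t r ⟩
  (at u v a - t) +ℤ r ∎
  where
  open ≡-Reasoning
  u = φ i
  u′ = φ (suc i)
  t = at (φ (targetIndex (suc i) bs)) v b
  r = divergence R (canonical R) g v
  rest = divergence (seriesEdges φ (suc i) bs ++ R) (canonical _) (values w φ (suc i) R g) v
  telescope : ∀ x y z r → (x - y) +ℤ ((y - z) +ℤ r) ≡ (x - z) +ℤ r
  telescope = solve-∀
divergence-series {D ∷ bs} {b = b} (D∷ p q _ _ refl refl w) φ i R g v = begin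
  (at u v p +ℤ at u′ v (- p)) +ℤ ((at u v q +ℤ at u′ v q) +ℤ rest)
    ≡⟨ cong₂ _+ℤ_ (cong (at u v p +ℤ_) (at-neg u′ v p))
                  (cong ((at u v q +ℤ at u′ v q) +ℤ_) (divergence-series w φ (suc i) R g v)) ⟩
  (at u v p - at u′ v p) +ℤ ((at u v q +ℤ at u′ v q) +ℤ ((at u′ v (p - q) - t) +ℤ r))
    ≡⟨ cong (λ x → (at u v p - at u′ v p) +ℤ ((at u v q +ℤ at u′ v q) +ℤ ((x - t) +ℤ r)))
            (at-− u′ v p q) ⟩
  (at u v p - at u′ v p) +ℤ ((at u v q +ℤ at u′ v q) +ℤ (((at u′ v p - at u′ v q) - t) +ℤ r))
    ≡⟨ telescope (at u v p) (at u v q) (at u′ v p) (at u′ v q) t r ⟩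
  ((at u v p +ℤ at u v q) - t) +ℤ r
    ≡⟨ cong (λ x → (x - t) +ℤ r) (sym (at-+ u v p q)) ⟩
  (at u v (p +ℤ q) - t) +ℤ r ∎
  where
  open ≡-Reasoning
  u = φ i
  u′ = φ (suc i)
  t = at (φ (targetIndex (suc i) bs)) v b
  r = divergence R (canonical R) g v
  rest = divergence (seriesEdges φ (suc i) bs ++ R) (canonical _) (values w φ (suc i) R g) v
  telescope : ∀ xp xq yp yq z r →
    (xp - yp) +ℤ ((xq +ℤ yq) +ℤ (((yp - yq) - z) +ℤ r)) ≡ ((xp +ℤ xq) - z) +ℤ r
  telescope = solve-∀

canonicalFlow : ∀ G (f : EdgeOf G → ℤ) → (∀ e → FlowValue (f e)) →
  (∀ v → divergence G (canonical G) f v ≡ 0ℤ) → NowhereZeroFlow 6 G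
canonicalFlow G f f✓ div≡0 =
  canonical G , f , (λ e → proj₁ (f✓ e)) , (λ e → proj₂ (f✓ e)) ,
  divergence≡0⇒conservation G (canonical G) f div≡0

noEdges : EdgeOf [] → ℤ
noEdges ()

noEdges-FlowValue : ∀ e → FlowValue (noEdges e)
noEdges-FlowValue ()

seriesFlow : ∀ bs → Pseudoflow bs 0ℤ 0ℤ → NowhereZeroFlow 6 (seriesGraph bs)
seriesFlow bs w = subst (NowhereZeroFlow 6) (++-identityʳ (seriesGraph bs))
  (canonicalFlow _ (values w id 0 [] noEdges) (values-FlowValue w id 0 [] noEdges noEdges-FlowValue)
    λ v → trans (divergence-series w id 0 [] noEdges v)
                (cong₂ (λ x y → (x - y) +ℤ 0ℤ) (at-0 0 v) (at-0 (targetIndex 0 bs) v)))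

relabel-target : ∀ ℓ₁ ℓ₂ → 1 ≤ ℓ₂ → relabel ℓ₁ ℓ₂ ℓ₂ ≡ ℓ₁
relabel-target ℓ₁ (suc ℓ₂) _ with suc ℓ₂ ≟ suc ℓ₂
... | yes _ = refl
... | no ≢  = ⊥-elim (≢ refl)

-- The negated pseudoflow on cs cancels the one on bs at both shared terminals.
necklaceFlow : ∀ bs cs {a b} → 1 ≤ length cs → Pseudoflow bs a b → Pseudoflow cs (- a) (- b) →
  NowhereZeroFlow 6 (necklaceGraph bs cs)
necklaceFlow bs cs {a} {b} cs≢[] w₁ w₂ =
  subst (NowhereZeroFlow 6) (cong (seriesGraph bs ++_) (++-identityʳ S₂))
  (canonicalFlow (seriesGraph bs ++ (S₂ ++ [])) (values w₁ id 0 (S₂ ++ []) f₂)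
    (values-FlowValue w₁ id 0 (S₂ ++ []) f₂ (values-FlowValue w₂ ψ 0 [] noEdges noEdges-FlowValue))
    λ v → begin
      divergence (seriesGraph bs ++ (S₂ ++ [])) (canonical _) (values w₁ id 0 (S₂ ++ []) f₂) v
        ≡⟨ divergence-series w₁ id 0 (S₂ ++ []) f₂ v ⟩
      (at 0 v a - at t₁ v b) +ℤ divergence (S₂ ++ []) (canonical _) f₂ v
        ≡⟨ cong ((at 0 v a - at t₁ v b) +ℤ_) (divergence-series w₂ ψ 0 [] noEdges v) ⟩
      (at 0 v a - at t₁ v b) +ℤ ((at 0 v (- a) - at t₂ v (- b)) +ℤ 0ℤ)
        ≡⟨ cong₂ (λ x y → (at 0 v a - at x v b) +ℤ ((at 0 v (- a) - at y v (- b)) +ℤ 0ℤ)) t₁≡ℓ t₂≡ℓ ⟩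
      (at 0 v a - at ℓ v b) +ℤ ((at 0 v (- a) - at ℓ v (- b)) +ℤ 0ℤ)
        ≡⟨ cong₂ (λ x y → (at 0 v a - at ℓ v b) +ℤ ((x - y) +ℤ 0ℤ)) (at-neg 0 v a) (at-neg ℓ v b) ⟩
      (at 0 v a - at ℓ v b) +ℤ ((- at 0 v a - - at ℓ v b) +ℤ 0ℤ)
        ≡⟨ cancel (at 0 v a) (at ℓ v b) ⟩
      0ℤ ∎)
  where
  open ≡-Reasoning
  ℓ = length bs
  ψ = relabel (length bs) (length cs)
  S₂ = seriesEdges ψ 0 cs
  f₂ = values w₂ ψ 0 [] noEdges
  t₁ t₂ : ℕ
  t₁ = targetIndex 0 bs
  t₂ = ψ (targetIndex 0 cs)
  t₁≡ℓ : t₁ ≡ ℓ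
  t₁≡ℓ = targetIndex-length 0 bs
  t₂≡ℓ : t₂ ≡ ℓ
  t₂≡ℓ = trans (cong ψ (targetIndex-length 0 cs)) (relabel-target ℓ (length cs) cs≢[])
  cancel : ∀ x y → (x - y) +ℤ ((- x - - y) +ℤ 0ℤ) ≡ 0ℤ
  cancel = solve-∀

alternating : ∀ xs → Pseudoflow (xs ∷ʳ D) (+ 2) 0ℤ × Pseudoflow (xs ∷ʳ D) (+ 4) 0ℤ
alternating [] =
  D∷ (+ 1) (+ 1) (flowValue (+ 1)) (flowValue (+ 1)) refl refl [] ,
  D∷ (+ 2) (+ 2) (flowValue (+ 2)) (flowValue (+ 2)) refl refl []
alternating (K2⁺ ∷ xs) with alternating xs
... | from2 , from4 = K2⁺∷ (flowValue (+ 2)) from2 , K2⁺∷ (flowValue (+ 4)) from4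
alternating (D ∷ xs) with alternating xs
... | from2 , from4 =
  D∷ (+ 3) (- + 1) (flowValue (+ 3)) (flowValue (- + 1)) refl refl from4 ,
  D∷ (+ 3) (+ 1) (flowValue (+ 3)) (flowValue (+ 1)) refl refl from2

data Colour : Set where
  one three five : Colour

value : Colour → ℤ
value one   = + 1
value three = + 3
value five  = + 5

-- Some walk of length k leads from x to t in the triangle on the colours.
Reachable : ℕ → Colour → Colour → Set
Reachable zero          x t = x ≡ t
Reachable (suc zero)    x t = x ≢ t
Reachable (suc (suc _)) x t = ⊤

avoiding : ∀ x t → Σ Colour λ z → z ≢ x × z ≢ t
avoiding one   one   = three , (λ ()) , (λ ())
avoiding one   three = five  , (λ ()) , (λ ())
avoiding one   five  = three , (λ ()) , (λ ())
avoiding three one   = five  , (λ ()) , (λ ())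
avoiding three three = one   , (λ ()) , (λ ())
avoiding three five  = one   , (λ ()) , (λ ())
avoiding five  one   = three , (λ ()) , (λ ())
avoiding five  three = one   , (λ ()) , (λ ())
avoiding five  five  = one   , (λ ()) , (λ ())

Reachable-step : ∀ k x t → Reachable (suc k) x t → Σ Colour λ z → z ≢ x × Reachable k z t
Reachable-step zero          x t x≢t = t , (λ t≡x → x≢t (sym t≡x)) , refl
Reachable-step (suc zero)    x t _   = avoiding x t
Reachable-step (suc (suc k)) x t _   = proj₁ (avoiding x x) , proj₁ (proj₂ (avoiding x x)) , tt

-- p = (value x + value z)/2 and q = (value x − value z)/2
D∷-recolour : ∀ {bs b} x z → z ≢ x → Pseudoflow bs (value z) b → Pseudoflow (D ∷ bs) (value x) b
D∷-recolour one   one   z≢x = ⊥-elim (z≢x refl)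
D∷-recolour one   three _ = D∷ (+ 2) (- + 1) (flowValue (+ 2)) (flowValue (- + 1)) refl refl
D∷-recolour one   five  _ = D∷ (+ 3) (- + 2) (flowValue (+ 3)) (flowValue (- + 2)) refl refl
D∷-recolour three one   _ = D∷ (+ 2) (+ 1) (flowValue (+ 2)) (flowValue (+ 1)) refl refl
D∷-recolour three three z≢x = ⊥-elim (z≢x refl)
D∷-recolour three five  _ = D∷ (+ 4) (- + 1) (flowValue (+ 4)) (flowValue (- + 1)) refl refl
D∷-recolour five  one   _ = D∷ (+ 3) (+ 2) (flowValue (+ 3)) (flowValue (+ 2)) refl refl
D∷-recolour five  three _ = D∷ (+ 4) (+ 1) (flowValue (+ 4)) (flowValue (+ 1)) refl refl
D∷-recolour five  five  z≢x = ⊥-elim (z≢x refl)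

dBlocks : List Block → ℕ
dBlocks []         = 0
dBlocks (K2⁺ ∷ bs) = dBlocks bs
dBlocks (D ∷ bs)   = suc (dBlocks bs)

coloured : ∀ bs x t → Reachable (dBlocks bs) x t → Pseudoflow bs (value x) (value t)
coloured []         x .x refl = []
coloured (K2⁺ ∷ bs) x t  r    = K2⁺∷ (value-FlowValue x) (coloured bs x t r)
  where
  value-FlowValue : ∀ x → FlowValue (value x)
  value-FlowValue one   = flowValue (+ 1)
  value-FlowValue three = flowValue (+ 3)
  value-FlowValue five  = flowValue (+ 5)
coloured (D ∷ bs)   x t  r with Reachable-step (dBlocks bs) x t r
... | z , z≢x , r′ = D∷-recolour x z z≢x (coloured bs z t r′)

commonTarget : ∀ k₁ k₂ → 2 ≤ k₁ + k₂ → Σ Colour λ t → Reachable k₁ one t × Reachable k₂ one t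
commonTarget zero          (suc (suc _)) _ = one , refl , tt
commonTarget (suc zero)    (suc zero)    _ = three , (λ ()) , (λ ())
commonTarget (suc zero)    (suc (suc _)) _ = three , (λ ()) , tt
commonTarget (suc (suc _)) zero          _ = one , tt , refl
commonTarget (suc (suc _)) (suc zero)    _ = three , tt , (λ ())
commonTarget (suc (suc _)) (suc (suc _)) _ = one , tt , tt
commonTarget zero          zero          ()
commonTarget zero          (suc zero)    (s≤s ())
commonTarget (suc zero)    zero          (s≤s ())

degree-++ : ∀ A B v → degree (A ++ B) v ≡ degree A v + degree B v
degree-++ A B v =
  trans (cong sum (map-++ (endsAt v) A B)) (sum-++ (map (endsAt v) A) (map (endsAt v) B))

incidence-≡ : ∀ x → incidence x x ≡ 1
incidence-≡ x with x ≟ x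
... | yes _  = refl
... | no x≢x = ⊥-elim (x≢x refl)

incidence-≢ : ∀ x v → x ≢ v → incidence x v ≡ 0
incidence-≢ x v x≢v with x ≟ v
... | yes x≡v = ⊥-elim (x≢v x≡v)
... | no _    = refl

degree-block-avoiding : ∀ b {u w v} → u ≢ v → w ≢ v → ∀ R →
  degree (blockEdges b u w ++ R) v ≡ degree R v
degree-block-avoiding K2⁺ {u} {w} {v} u≢v w≢v R
  rewrite incidence-≢ u v u≢v | incidence-≢ w v w≢v = refl
degree-block-avoiding D   {u} {w} {v} u≢v w≢v R
  rewrite incidence-≢ u v u≢v | incidence-≢ w v w≢v = refl

outside⇒≢ : ∀ {i j t v} → i ≤ j → j ≤ t → v < i ⊎ t < v → j ≢ v
outside⇒≢ i≤j j≤t (inj₁ v<i) = ℕ.>⇒≢ (ℕ.<-≤-trans v<i i≤j)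
outside⇒≢ i≤j j≤t (inj₂ t<v) = ℕ.<⇒≢ (ℕ.≤-<-trans j≤t t<v)

targetIndex-≥ : ∀ i bs → i ≤ targetIndex i bs
targetIndex-≥ i bs = subst (i ≤_) (sym (targetIndex-length i bs)) (ℕ.m≤m+n i (length bs))

degree-series-outside : ∀ i bs v → v < i ⊎ targetIndex i bs < v →
  degree (seriesEdges id i bs) v ≡ 0
degree-series-outside i []       v _   = refl
degree-series-outside i (b ∷ bs) v out =
  trans (degree-block-avoiding b (outside⇒≢ ℕ.≤-refl (ℕ.<⇒≤ suc-i≤t) out)
                                 (outside⇒≢ (ℕ.n≤1+n i) suc-i≤t out) _)
        (degree-series-outside (suc i) bs v (Sum.map₁ ℕ.m≤n⇒m≤1+n out))
  where
  suc-i≤t : suc i ≤ targetIndex (suc i) bs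
  suc-i≤t = targetIndex-≥ (suc i) bs

seriesEdges-++ : ∀ φ i xs ys →
  seriesEdges φ i (xs ++ ys) ≡ seriesEdges φ i xs ++ seriesEdges φ (targetIndex i xs) ys
seriesEdges-++ φ i []       ys = refl
seriesEdges-++ φ i (b ∷ xs) ys =
  trans (cong (blockEdges b (φ i) (φ (suc i)) ++_) (seriesEdges-++ φ (suc i) xs ys))
        (sym (++-assoc (blockEdges b (φ i) (φ (suc i))) _ _))

degree-source : ∀ bs → degree (seriesGraph (K2⁺ ∷ bs)) 0 ≡ 1
degree-source bs = cong suc (degree-series-outside 1 bs 0 (inj₁ (s≤s z≤n)))

degree-target : ∀ xs → degree (seriesGraph (xs ∷ʳ K2⁺)) (suc (targetIndex 0 xs)) ≡ 1
degree-target xs = begin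
  degree (seriesGraph (xs ++ K2⁺ ∷ [])) (suc n)
    ≡⟨ cong (λ G → degree G (suc n)) (seriesEdges-++ id 0 xs (K2⁺ ∷ [])) ⟩
  degree (seriesGraph xs ++ edge n (suc n) pos ∷ []) (suc n)
    ≡⟨ degree-++ (seriesGraph xs) _ (suc n) ⟩
  degree (seriesGraph xs) (suc n) + ((incidence n (suc n) + incidence (suc n) (suc n)) + 0)
    ≡⟨ cong₂ (λ x y → x + ((y + incidence (suc n) (suc n)) + 0))
             (degree-series-outside 0 xs (suc n) (inj₂ (ℕ.n<1+n n)))
             (incidence-≢ n (suc n) (ℕ.<⇒≢ (ℕ.n<1+n n))) ⟩
  incidence (suc n) (suc n) + 0
    ≡⟨ cong (_+ 0) (incidence-≡ (suc n)) ⟩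
  1 ∎
  where
  open ≡-Reasoning
  n = targetIndex 0 xs

negatives-++ : ∀ A B → negatives (A ++ B) ≡ negatives A + negatives B
negatives-++ A B = trans (cong sum (map-++ c A B)) (sum-++ (map c A) (map c B))
  where
  c : Edge → ℕ
  c x = negativity (sign x)

negatives-series : ∀ φ i bs → negatives (seriesEdges φ i bs) ≡ dBlocks bs
negatives-series φ i []         = refl
negatives-series φ i (K2⁺ ∷ bs) = negatives-series φ (suc i) bs
negatives-series φ i (D ∷ bs)   = cong suc (negatives-series φ (suc i) bs)

negatives-necklace : ∀ bs cs → negatives (necklaceGraph bs cs) ≡ dBlocks bs + dBlocks cs
negatives-necklace bs cs =
  trans (negatives-++ (seriesGraph bs) _) (cong₂ _+_ (negatives-series id 0 bs) (negatives-series _ 0 cs))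

lookup-series-D-free : ∀ i bs → dBlocks bs ≡ 0 → ∀ e →
  lookup (seriesEdges id i bs) e ≡ edge (i + toℕ e) (suc (i + toℕ e)) pos
lookup-series-D-free i (K2⁺ ∷ bs) _   zero    = cong (λ j → edge j (suc j) pos) (sym (ℕ.+-identityʳ i))
lookup-series-D-free i (K2⁺ ∷ bs) noD (suc e) =
  trans (lookup-series-D-free (suc i) bs noD e) (cong (λ j → edge j (suc j) pos) (sym (ℕ.+-suc i (toℕ e))))

sameEnds-consecutive : ∀ j k → SameEnds (edge j (suc j) pos) (edge k (suc k) pos) → j ≡ k
sameEnds-consecutive j k (inj₁ (j≡k , _))         = j≡k
sameEnds-consecutive j k (inj₂ (j≡1+k , 1+j≡k)) = ⊥-elim (ℕ.m≢1+n+m k (trans (sym 1+j≡k) (cong suc j≡1+k)))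

-- Vertex 1 lies in a 2-cycle, but no two edges of a D-free series graph are parallel.
D-freeString⇒¬Nontrivial : ∀ bs → IsString bs → dBlocks bs ≡ 0 → ¬ Nontrivial bs
D-freeString⇒¬Nontrivial bs (_ , inner2Cycle) noD nontrivial
  with inner2Cycle 1 (s≤s z≤n) nontrivial
... | e , e′ , e≢e′ , sameEnds , _ =
  e≢e′ (toℕ-injective (sameEnds-consecutive _ _
    (subst₂ SameEnds (lookup-series-D-free 0 bs noD e) (lookup-series-D-free 0 bs noD e′) sameEnds)))

string-6flow : ∀ bs → IsString bs →
  FlowAdmissible (seriesGraph bs) → NowhereZeroFlow 6 (seriesGraph bs)
string-6flow []         (() , _) _
string-6flow (K2⁺ ∷ bs) _ (k , flow) = ⊥-elim (degree≡1⇒¬flow _ k 0 (degree-source bs) flow)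
string-6flow (D ∷ bs)   _ (k , flow) with initLast bs
... | []         = ⊥-elim (negatives≡1⇒¬flow _ k refl flow)
... | xs ∷ʳ′ D   =
  seriesFlow _ (D∷ (+ 1) (- + 1) (flowValue (+ 1)) (flowValue (- + 1)) refl refl (proj₁ (alternating xs)))
... | xs ∷ʳ′ K2⁺ =
  ⊥-elim (degree≡1⇒¬flow _ k (suc (targetIndex 0 (D ∷ xs))) (degree-target (D ∷ xs)) flow)

necklace-6flow : ∀ bs cs → IsNecklace bs cs →
  FlowAdmissible (necklaceGraph bs cs) → NowhereZeroFlow 6 (necklaceGraph bs cs)
necklace-6flow bs cs (bs-string , cs-string , nontrivial) (k , flow)
  with dBlocks bs + dBlocks cs in total
... | 0 = ⊥-elim (Sum.[ D-freeString⇒¬Nontrivial bs bs-string (ℕ.m+n≡0⇒m≡0 _ total)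
                      , D-freeString⇒¬Nontrivial cs cs-string (ℕ.m+n≡0⇒n≡0 _ total) ] nontrivial)
... | 1 = ⊥-elim (negatives≡1⇒¬flow _ k (trans (negatives-necklace bs cs) total) flow)
... | suc (suc _)
  with commonTarget (dBlocks bs) (dBlocks cs) (subst (2 ≤_) (sym total) (s≤s (s≤s z≤n)))
...   | t , reach₁ , reach₂ =
  necklaceFlow bs cs (proj₁ cs-string)
    (coloured bs one t reach₁) (Pseudoflow-neg (coloured cs one t reach₂))

corollary16 :
    (∀ (bs : List Block) → IsString bs →
       FlowAdmissible (seriesGraph bs) → NowhereZeroFlow 6 (seriesGraph bs))
    ×
    (∀ (bs cs : List Block) → IsNecklace bs cs →
       FlowAdmissible (necklaceGraph bs cs) → NowhereZeroFlow 6 (necklaceGraph bs cs))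
corollary16 = string-6flow , necklace-6flow
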